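{- Let an instance of the BPMSTP with $N$ jobs, $M$ machines and $K$ time slots admit at least one feasible solution. Then $$|\mathcal{P}_\mathcal{J}|\le\left\lfloor\frac{ -1+\sqrt{1+8MK}}{2}\right\rfloor,$$ where $\mathcal{P}_\mathcal{J}$ is the set of distinct processing times of the jobs.
   Context: BPMSTP: job set $\mathcal{J}=\{1,\dots,N\}$, each job $j$ with integer processing time $1\le p_j\le K$; machine set $\mathcal{H}=\{1,\dots,M\}$ of identical machines with rates $u_h\ge0$; time slots $\mathcal{T}=\{1,\dots,K\}$ with costs $c_t\ge0$. A feasible solution (feasible schedule) assigns each job $j$ to one machine $h_j\in\mathcal{H}$ and to a set $\mathcal{T}_j\subseteq\mathcal{T}$ of $p_j$ consecutive time slots, such that two distinct jobs on the same machine use disjoint sets of slots. $\mathcal{P}_\mathcal{J}=\{d:\exists j\in\mathcal{J},\ p_j=d\}$. -}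

module Defs where

open import Data.Nat using (ℕ; suc; _+_; _*_; _∸_; _≤_; _<_; _≤?_)
open import Data.Nat.Properties using (_≟_)
open import Data.Nat.DivMod using (_/_)
open import Data.Fin using (Fin)
open import Data.List using (List; length; map; filter; upTo; allFin; deduplicate)
open import Data.Product using (_×_; Σ)
open import Relation.Binary.PropositionalEquality using (_≡_)
open import Relation.Nullary using (¬_)

-- Time slots are 1..K. Job j with start offset s j occupies the
-- p j consecutive slots  s j + 1, …, s j + p j.
SlotOf : ℕ → ℕ → ℕ → Set
SlotOf s p t = (s < t) × (t ≤ s + p)

-- An instance: N jobs with processing times p : Fin N → ℕ, M machines, K slots.
-- (Rates u_h and costs c_t play no role in feasibility.)
record FeasibleSchedule (N M K : ℕ) (p : Fin N → ℕ) : Set where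
  field
    machine : Fin N → Fin M
    start   : Fin N → ℕ
    inHorizon : ∀ j → start j + p j ≤ K
    disjoint  : ∀ j j' → ¬ (j ≡ j') → machine j ≡ machine j' →
                ∀ t → ¬ (SlotOf (start j) (p j) t × SlotOf (start j') (p j') t)

distinctTimes : (N : ℕ) → (Fin N → ℕ) → List ℕ
distinctTimes N p = deduplicate _≟_ (map p (allFin N))

cardP : (N : ℕ) → (Fin N → ℕ) → ℕ
cardP N p = length (distinctTimes N p)

-- ⌊√n⌋ = number of r ∈ {1..n} with r*r ≤ n
floorSqrt : ℕ → ℕ
floorSqrt n = length (filter (λ r → r * r ≤? n) (map suc (upTo n)))

-- ⌊(-1 + √(1+8MK))/2⌋ = ⌊(⌊√(1+8MK)⌋ - 1)/2⌋
bound : ℕ → ℕ → ℕ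
bound M K = (floorSqrt (1 + 8 * M * K) ∸ 1) / 2

-- Choosing one job per
-- distinct processing time, these jobs occupy pairwise different cells, so the k = |P_J| distinct
-- times sum to at most MK; being k distinct positive integers they also sum to at least
-- k(k+1)/2.  Hence k(k+1)/2 ≤ MK, i.e. (2k+1)² ≤ 1 + 8MK, which is the claimed bound.
module Submission where

open import Defs
open import Data.Nat using (ℕ; zero; suc; _+_; _*_; _∸_; _≤_; _<_; _≤?_; z≤n; s≤s; s≤s⁻¹; z<s; s<s)
open import Data.Nat.Properties
open import Data.Nat.DivMod using (_/_; m*n/n≡m; /-mono-≤)
open import Data.Nat.ListAction using (sum)
open import Data.Nat.ListAction.Properties using (sum-↭)
open import Data.Nat.Tactic.RingSolver using (solve-∀)
open import Data.Fin using (Fin; toℕ; fromℕ<; combine)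
open import Data.Fin.Properties
  using (toℕ<n; toℕ-injective; toℕ-fromℕ<; fromℕ<-injective; combine-injectiveˡ; combine-injectiveʳ; injective⇒≤)
  renaming (_≟_ to _≟ᶠ_)
open import Data.List using (List; []; _∷_; _++_; length; map; filter; concat; lookup; tabulate; applyUpTo; allFin)
open import Data.List.Properties using (length-++; length-tabulate; filter-all; filter-accept; filter-reject; map-upTo)
open import Data.List.Relation.Unary.All as All using (All; []; _∷_)
open import Data.List.Relation.Unary.All.Properties using (¬Any⇒All¬; All¬⇒¬Any; all-filter)
import Data.List.Relation.Unary.All.Properties as All
import Data.List.Relation.Unary.AllPairs as AllPairs
import Data.List.Relation.Unary.AllPairs.Properties as AllPairs
open import Data.List.Relation.Unary.Any using (here; there)
open import Data.List.Relation.Unary.Unique.Propositional using (Unique; []; _∷_)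
import Data.List.Relation.Unary.Unique.Propositional.Properties as Unique
open import Data.List.Relation.Unary.Unique.DecPropositional.Properties _≟_ using (deduplicate-!)
open import Data.List.Relation.Binary.Disjoint.Propositional using (Disjoint)
open import Data.List.Relation.Binary.Permutation.Propositional using (_↭_; ↭-refl; ↭-prep; ↭-swap; ↭-trans)
open import Data.List.Relation.Binary.Permutation.Propositional.Properties using (↭-length)
open import Data.List.Membership.Propositional using (_∈_; _∉_)
open import Data.List.Membership.Propositional.Properties using (∈-lookup; ∈-tabulate⁻; ∈-map⁻; ∈-deduplicate⁻)
open import Data.List.Membership.DecPropositional _≟_ using (_∈?_)
open import Data.Product using (∃; _×_; _,_; proj₁)
open import Function using (_∘_)
open import Level using (Level)
open import Function.Definitions using (Injective)
open import Relation.Nullary using (yes; no; ¬?; contradiction)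
open import Relation.Unary using (Pred; Decidable)
open import Relation.Binary.PropositionalEquality using (_≡_; _≢_; refl; sym; cong; cong₂; subst; subst₂; ≢-sym; module ≡-Reasoning)

private
  variable
    a : Level
    A B : Set a
    k m n : ℕ
    xs : List ℕ

Unique⇒lookup-injective : {ys : List A} → Unique ys → Injective _≡_ _≡_ (lookup ys)
Unique⇒lookup-injective (_ ∷ _) {Fin.zero} {Fin.zero} _ = refl
Unique⇒lookup-injective (y∉ ∷ _) {Fin.zero} {Fin.suc j} eq = contradiction eq (All.lookup y∉ (∈-lookup j))
Unique⇒lookup-injective (y∉ ∷ _) {Fin.suc i} {Fin.zero} eq = contradiction (sym eq) (All.lookup y∉ (∈-lookup i))
Unique⇒lookup-injective (_ ∷ u) {Fin.suc i} {Fin.suc j} eq = cong Fin.suc (Unique⇒lookup-injective u eq)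

Unique⇒length≤ : {ys : List (Fin n)} → Unique ys → length ys ≤ n
Unique⇒length≤ u = injective⇒≤ (Unique⇒lookup-injective u)

Unique⇒length≤-bounded : Unique xs → All (_< n) xs → length xs ≤ n
Unique⇒length≤-bounded {xs} {n} u xs<n = injective⇒≤ {f = index} index-injective
  where
  index : Fin (length xs) → Fin n
  index i = fromℕ< (All.lookup xs<n (∈-lookup i))
  index-injective : Injective _≡_ _≡_ index
  index-injective = Unique⇒lookup-injective u ∘ fromℕ<-injective _ _ _ _

-- Prepending 0 keeps the list duplicate-free and puts it below suc n.
Unique⇒length≤-positive : Unique xs → All (λ x → 1 ≤ x × x ≤ n) xs → length xs ≤ n
Unique⇒length≤-positive u xs∈ = s≤s⁻¹ (Unique⇒length≤-bounded
  (All.map (λ (1≤x , _) → <⇒≢ 1≤x) xs∈ ∷ u)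
  (z<s ∷ All.map (λ (_ , x≤n) → s≤s x≤n) xs∈))

infixl 6 _without_

_without_ : List ℕ → ℕ → List ℕ
xs without m = filter (λ x → ¬? (m ≟ x)) xs

without-∉ : m ∉ xs → xs without m ≡ xs
without-∉ {m} {xs} m∉ = filter-all (λ x → ¬? (m ≟ x)) (¬Any⇒All¬ xs m∉)

Unique⇒↭∷without : Unique xs → m ∈ xs → xs ↭ m ∷ xs without m
Unique⇒↭∷without {x ∷ xs} (x∉ ∷ _) (here refl)
  rewrite filter-reject (λ y → ¬? (x ≟ y)) {x} {xs} (λ x≢x → x≢x refl)
        | without-∉ (All¬⇒¬Any x∉) = ↭-refl
Unique⇒↭∷without {x ∷ xs} {m} (x∉ ∷ u) (there m∈)
  rewrite filter-accept (λ y → ¬? (m ≟ y)) {x} {xs} (≢-sym (All.lookup x∉ m∈)) =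
  ↭-trans (↭-prep x (Unique⇒↭∷without u m∈)) (↭-swap x m ↭-refl)

∈⇒≤sum : m ∈ xs → m ≤ sum xs
∈⇒≤sum {xs = x ∷ xs} (here refl) = m≤m+n x (sum xs)
∈⇒≤sum {xs = x ∷ xs} (there m∈) = ≤-trans (∈⇒≤sum m∈) (m≤n+m (sum xs) x)

triangular-step : k ≤ m → k * suc k ≤ 2 * n → suc k * suc (suc k) ≤ 2 * (suc m + n)
triangular-step {k} {m} {n} k≤m ih = begin
  suc k * suc (suc k)     ≡⟨ expand k ⟩
  2 * suc k + k * suc k   ≤⟨ +-mono-≤ (*-monoʳ-≤ 2 (s≤s k≤m)) ih ⟩
  2 * suc m + 2 * n       ≡⟨ *-distribˡ-+ 2 (suc m) n ⟨
  2 * (suc m + n)         ∎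
  where
  open ≤-Reasoning
  expand : ∀ k → suc k * suc (suc k) ≡ 2 * suc k + k * suc k
  expand = solve-∀

Unique⇒triangular≤sum : Unique xs → All (1 ≤_) xs → length xs * suc (length xs) ≤ 2 * sum xs
Unique⇒triangular≤sum {xs} u pos = bounded (sum xs) u (All.zip (pos , All.tabulate ∈⇒≤sum))
  where
  below : ∀ {m zs} → All (suc m ≢_) zs → All (λ z → 1 ≤ z × z ≤ suc m) zs → All (λ z → 1 ≤ z × z ≤ m) zs
  below ≢s ≤s = All.zipWith (λ (m+1≢z , 1≤z , z≤m+1) → 1≤z , s≤s⁻¹ (≤∧≢⇒< z≤m+1 (≢-sym m+1≢z))) (≢s , ≤s)

  -- Induction on an upper bound n: if n occurs in ys, remove it; the other elements lie in
  -- [1, n-1], so there are at most n-1 of them.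
  bounded : ∀ n {ys} → Unique ys → All (λ y → 1 ≤ y × y ≤ n) ys → length ys * suc (length ys) ≤ 2 * sum ys
  bounded zero {[]} _ _ = z≤n
  bounded zero {_ ∷ _} _ ((1≤y , y≤0) ∷ _) = contradiction (≤-trans 1≤y y≤0) λ ()
  bounded (suc m) {ys} u ys∈ with suc m ∈? ys
  ... | no m+1∉ = bounded m u (below (¬Any⇒All¬ ys m+1∉) ys∈)
  ... | yes m+1∈ = subst₂ (λ l s → l * suc l ≤ 2 * s) (sym (↭-length π)) (sym (sum-↭ π))
      (triangular-step (Unique⇒length≤-positive u′ ys′∈) (bounded m u′ ys′∈))
    where
    π : ys ↭ suc m ∷ ys without suc m
    π = Unique⇒↭∷without u m+1∈
    u′ : Unique (ys without suc m)
    u′ = Unique.filter⁺ _ u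
    ys′∈ : All (λ y → 1 ≤ y × y ≤ m) (ys without suc m)
    ys′∈ = below (all-filter _ ys) (All.filter⁺ _ ys∈)

≤-length-filter-applyUpTo : ∀ {p} {P : Pred ℕ p} (P? : Decidable P) (f : ℕ → ℕ) {r n} →
  r ≤ n → (∀ {i} → i < r → P (f i)) → r ≤ length (filter P? (applyUpTo f n))
≤-length-filter-applyUpTo P? f {zero} _ _ = z≤n
≤-length-filter-applyUpTo P? f {suc r} {suc n} (s≤s r≤n) Pf
  rewrite filter-accept P? {f 0} {applyUpTo (f ∘ suc) n} (Pf z<s) =
  s≤s (≤-length-filter-applyUpTo P? (f ∘ suc) r≤n (Pf ∘ s<s))

≤-floorSqrt : ∀ {r} → r * r ≤ n → r ≤ floorSqrt n
≤-floorSqrt {n} {r} r²≤n rewrite map-upTo suc n =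
  ≤-length-filter-applyUpTo (λ s → s * s ≤? n) suc (≤-trans (r≤r² r) r²≤n)
    (λ i<r → ≤-trans (*-mono-≤ i<r i<r) r²≤n)
  where
  r≤r² : ∀ r → r ≤ r * r
  r≤r² zero = z≤n
  r≤r² r@(suc _) = m≤m*n r r

triangular⇒≤bound : ∀ {M K} → k * suc k ≤ 2 * (M * K) → k ≤ bound M K
triangular⇒≤bound {k} {M} {K} ≤2MK = begin
  k                                     ≡⟨ m*n/n≡m k 2 ⟨
  k * 2 / 2                             ≤⟨ /-mono-≤ (∸-monoˡ-≤ 1 (≤-floorSqrt {r = suc (k * 2)} odd²≤)) ≤-refl ⟩
  (floorSqrt (1 + 8 * M * K) ∸ 1) / 2   ∎
  where
  open ≤-Reasoning
  odd² : ∀ k → suc (k * 2) * suc (k * 2) ≡ 1 + 4 * (k * suc k)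
  odd² = solve-∀
  8MK : ∀ M K → 1 + 8 * M * K ≡ 1 + 4 * (2 * (M * K))
  8MK = solve-∀
  odd²≤ : suc (k * 2) * suc (k * 2) ≤ 1 + 8 * M * K
  odd²≤ = subst₂ _≤_ (sym (odd² k)) (sym (8MK M K)) (s≤s (*-monoʳ-≤ 4 ≤2MK))

map-reduce-preimages : ∀ {f : A → B} {ys} (ys∈ : All (λ y → ∃ λ x → y ≡ f x) ys) →
  map f (All.reduce proj₁ ys∈) ≡ ys
map-reduce-preimages [] = refl
map-reduce-preimages ((_ , refl) ∷ ys∈) = cong (_ ∷_) (map-reduce-preimages ys∈)

module _ {N M K : ℕ} {p : Fin N → ℕ} (S : FeasibleSchedule N M K p) where
  open FeasibleSchedule S

  -- 0-based index of the time slot start j + t + 1 in which job j spends its t-th unit.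
  slot : (j : Fin N) → Fin (p j) → Fin K
  slot j t = fromℕ< (<-≤-trans (+-monoʳ-< (start j) (toℕ<n t)) (inHorizon j))

  cell : (j : Fin N) → Fin (p j) → Fin (M * K)
  cell j t = combine (machine j) (slot j t)

  slot-occupied : ∀ j t → SlotOf (start j) (p j) (suc (toℕ (slot j t)))
  slot-occupied j t = subst (SlotOf (start j) (p j) ∘ suc) (sym (toℕ-fromℕ< _))
    (s≤s (m≤m+n (start j) (toℕ t)) , +-monoʳ-< (start j) (toℕ<n t))

  cell-injectiveʳ : ∀ j → Injective _≡_ _≡_ (cell j)
  cell-injectiveʳ j {t} {t′} eq = toℕ-injective (+-cancelˡ-≡ (start j) _ _
    (fromℕ<-injective _ _ _ _ (combine-injectiveʳ (machine j) _ (machine j) _ eq)))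

  cell-injectiveˡ : ∀ {j j′ t t′} → cell j t ≡ cell j′ t′ → j ≡ j′
  cell-injectiveˡ {j} {j′} {t} {t′} eq with j ≟ᶠ j′
  ... | yes j≡j′ = j≡j′
  ... | no j≢j′ = contradiction (slot-occupied j t , shared-slot) (disjoint j j′ j≢j′ same-machine _)
    where
    same-machine : machine j ≡ machine j′
    same-machine = combine-injectiveˡ (machine j) _ (machine j′) _ eq
    same-slot : slot j t ≡ slot j′ t′
    same-slot = combine-injectiveʳ (machine j) _ (machine j′) _ eq
    shared-slot : SlotOf (start j′) (p j′) (suc (toℕ (slot j t)))
    shared-slot = subst (SlotOf (start j′) (p j′) ∘ suc ∘ toℕ) (sym same-slot) (slot-occupied j′ t′)

  cellsOf : Fin N → List (Fin (M * K))
  cellsOf j = tabulate (cell j)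

  occupied : List (Fin N) → List (Fin (M * K))
  occupied js = concat (map cellsOf js)

  length-occupied : ∀ js → length (occupied js) ≡ sum (map p js)
  length-occupied [] = refl
  length-occupied (j ∷ js) = begin
    length (cellsOf j ++ occupied js)        ≡⟨ length-++ (cellsOf j) ⟩
    length (cellsOf j) + length (occupied js) ≡⟨ cong₂ _+_ (length-tabulate (cell j)) (length-occupied js) ⟩
    p j + sum (map p js)                      ∎
    where open ≡-Reasoning

  occupied-Unique : ∀ {js} → Unique js → Unique (occupied js)
  occupied-Unique u = Unique.concat⁺
    (All.map⁺ (All.universal (λ j → Unique.tabulate⁺ (cell-injectiveʳ j)) _))
    (AllPairs.map⁺ (AllPairs.map cellsOf-disjoint u))
    where
    cellsOf-disjoint : ∀ {j j′} → j ≢ j′ → Disjoint (cellsOf j) (cellsOf j′)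
    cellsOf-disjoint j≢j′ (v∈ , v∈′) with ∈-tabulate⁻ v∈ | ∈-tabulate⁻ v∈′
    ... | _ , refl | _ , eq = j≢j′ (cell-injectiveˡ eq)

  sum≤capacity : ∀ {js} → Unique js → sum (map p js) ≤ M * K
  sum≤capacity {js} u = subst (_≤ M * K) (length-occupied js) (Unique⇒length≤ (occupied-Unique u))

distinctTimes-Unique : ∀ N (p : Fin N → ℕ) → Unique (distinctTimes N p)
distinctTimes-Unique N p = deduplicate-! (map p (allFin N))

distinctTimes-preimages : ∀ N (p : Fin N → ℕ) → All (λ d → ∃ λ j → d ≡ p j) (distinctTimes N p)
distinctTimes-preimages N p = All.tabulate λ d∈ →
  let (j , _ , d≡pj) = ∈-map⁻ p (∈-deduplicate⁻ _≟_ (map p (allFin N)) d∈) in j , d≡pj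

mainTheorem2 : (N M K : ℕ) (p : Fin N → ℕ) →
    (∀ j → 1 ≤ p j) → (∀ j → p j ≤ K) →
    FeasibleSchedule N M K p →
    cardP N p ≤ bound M K
mainTheorem2 N M K p p≥1 _ S = triangular⇒≤bound {M = M} {K = K} (begin
  length D * suc (length D)  ≤⟨ Unique⇒triangular≤sum (distinctTimes-Unique N p) D-positive ⟩
  2 * sum D                  ≡⟨ cong (λ ds → 2 * sum ds) (map-reduce-preimages preimages) ⟨
  2 * sum (map p js)         ≤⟨ *-monoʳ-≤ 2 (sum≤capacity S js-Unique) ⟩
  2 * (M * K)                ∎)
  where
  open ≤-Reasoning
  D : List ℕ
  D = distinctTimes N p
  preimages : All (λ d → ∃ λ j → d ≡ p j) D
  preimages = distinctTimes-preimages N p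
  D-positive : All (1 ≤_) D
  D-positive = All.map (λ { (j , refl) → p≥1 j }) preimages
  js : List (Fin N)
  js = All.reduce proj₁ preimages
  js-Unique : Unique js
  js-Unique = Unique.map⁻ (subst Unique (sym (map-reduce-preimages preimages)) (distinctTimes-Unique N p))
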